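{- Every propositional logic $\mathbf{L}$ (over a propositional language with finitely many connectives) has a sequential approximation.
   Context: A propositional language has variables $X_1,X_2,\dots$ and finitely many connectives with fixed arities; $\mathrm{Frm}$ is its set of formulas. A substitution maps variables to formulas. A propositional logic is a subset $\mathbf{L}\subseteq\mathrm{Frm}$ closed under substitution. A finite-valued logic $\mathbf{M}$ consists of a finite set $V(\mathbf{M})$ of truth values, a subset $V^+(\mathbf{M})$ of designated values, and a truth function $V(\mathbf{M})^n\to V(\mathbf{M})$ for each $n$-ary connective; valuations map variables to truth values and extend to formulas; $\mathrm{Taut}(\mathbf{M})$ is the set of formulas designated under every valuation. Write $\mathbf{M}\unlhd\mathbf{M}'$ if $\mathrm{Taut}(\mathbf{M})\subseteq\mathrm{Taut}(\mathbf{M}')$. A sequential approximation of $\mathbf{L}$ is a sequence $\langle\mathbf{M}_1,\mathbf{M}_2,\dots\rangle$ of finite-valued logics such that $\mathbf{M}_i\unlhd\mathbf{M}_j$ whenever $i\ge j$, and $\mathbf{L}=\bigcap_{j}\mathrm{Taut}(\mathbf{M}_j)$. -}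

module Defs where

open import Data.Nat using (ℕ; _≥_)
open import Data.Fin using (Fin)
open import Data.Vec using (Vec; []; _∷_)
open import Data.Product using (Σ; _×_)
open import Function.Bundles using (_⇔_)

record Language : Set where
  field
    nConn : ℕ
    arity : Fin nConn → ℕ

module _ (𝓛 : Language) where
  open Language 𝓛

  data Frm : Set where
    var : ℕ → Frm
    app : (c : Fin nConn) → Vec Frm (arity c) → Frm

  Substitution : Set
  Substitution = ℕ → Frm

  mutual
    subst : Substitution → Frm → Frm
    subst σ (var x)    = σ x
    subst σ (app c as) = app c (substs σ as)

    substs : ∀ {n} → Substitution → Vec Frm n → Vec Frm n
    substs σ []       = []
    substs σ (a ∷ as) = subst σ a ∷ substs σ as

  -- A propositional logic: a set of formulas closed under substitution.
  ClosedUnderSubst : (Frm → Set) → Set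
  ClosedUnderSubst L = ∀ (σ : Substitution) (φ : Frm) → L φ → L (subst σ φ)

  record FiniteValuedLogic : Set₁ where
    field
      size       : ℕ
      designated : Fin size → Set
      op         : (c : Fin nConn) → Vec (Fin size) (arity c) → Fin size

  module _ (M : FiniteValuedLogic) where
    open FiniteValuedLogic M

    Valuation : Set
    Valuation = ℕ → Fin size

    mutual
      eval : Valuation → Frm → Fin size
      eval v (var x)    = v x
      eval v (app c as) = op c (evals v as)

      evals : ∀ {n} → Valuation → Vec Frm n → Vec (Fin size) n
      evals v []       = []
      evals v (a ∷ as) = eval v a ∷ evals v as

    Taut : Frm → Set
    Taut φ = ∀ (v : Valuation) → designated (eval v φ)

  _⊴_ : FiniteValuedLogic → FiniteValuedLogic → Set
  M ⊴ M' = ∀ (φ : Frm) → Taut M φ → Taut M' φ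

  SequentialApproximation : (Frm → Set) → (ℕ → FiniteValuedLogic) → Set
  SequentialApproximation L M =
    (∀ i j → i ≥ j → M i ⊴ M j) ×
    (∀ (φ : Frm) → L φ ⇔ (∀ j → Taut (M j) φ))

-- Cut the Lindenbaum matrix of L down to a finite list S of formulas: the
-- values are the formulas of S plus one designated value "undefined", and a
-- connective applied to formulas of S yields their composite if it lies in S
-- and "undefined" otherwise.  A valuation evaluates φ either to "undefined"
-- or to a substitution instance σ φ all of whose intermediate instances lie
-- in S, and every such σ is realised by a valuation.  So φ is a tautology of
-- the cut-down matrix iff all its S-instances lie in L.  Hence closure under
-- substitution puts L inside every such matrix's tautologies, enlarging S
-- only removes tautologies, and a tautology whose subformulas all lie in S
-- belongs to L; an increasing sequence of finite lists exhausting all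
-- formulas therefore gives a sequential approximation.
module Submission where

open import Defs
open import Data.Nat using (ℕ; zero; suc; _≤_; _≥_; _≤′_; ≤′-refl; ≤′-step; _⊔_)
open import Data.Nat.Properties using (≤⇒≤′; n≤1+n; m≤m⊔n; m≤n⊔m)
import Data.Nat.Properties as ℕ
open import Data.Fin using (Fin; zero; suc)
import Data.Fin.Properties as Fin
open import Data.List using (List; []; _∷_; _++_; [_]; length; lookup; map; concatMap; allFin)
open import Data.List.Membership.Propositional using (_∈_; lose)
open import Data.List.Membership.Propositional.Properties
  using (∈-lookup; ∈-map⁺; ∈-concatMap⁺; ∈-allFin; ∈-++⁺ʳ)
open import Data.List.Membership.DecPropositional using (_∈?_)
open import Data.List.Relation.Binary.Subset.Propositional using (_⊆_)
open import Data.List.Relation.Binary.Subset.Propositional.Properties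
  using (⊆-refl; ⊆-trans; xs⊆xs++ys)
open import Data.List.Relation.Unary.Any using (here; there; index)
open import Data.List.Relation.Unary.Any.Properties using (lookup-index)
open import Data.Maybe using (Maybe; just; nothing; maybe; fromMaybe)
open import Data.Maybe.Effectful using (monad)
import Data.Maybe.Relation.Unary.All as Maybe
open import Data.Product using (Σ; ∃; _×_; _,_)
open import Data.Vec using (Vec; []; _∷_)
open import Data.Vec.Effectful using (module TraversableM)
open import Data.Vec.Relation.Unary.All using (All; []; _∷_)
open import Function using (_∘_)
open import Function.Bundles using (_⇔_; mk⇔; Equivalence)
open import Level using (0ℓ)
open import Relation.Binary.Definitions using (DecidableEquality)
open import Relation.Binary.PropositionalEquality
  using (_≡_; refl; sym; cong; cong₂)
  renaming (subst to transport)
open import Relation.Nullary using (yes; no; contradiction)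

open TraversableM (monad {0ℓ}) using (mapM)

vectorsOver : ∀ {A : Set} → List A → (n : ℕ) → List (Vec A n)
vectorsOver xs zero    = [ [] ]
vectorsOver xs (suc n) = concatMap (λ x → map (x ∷_) (vectorsOver xs n)) xs

∈-vectorsOver : ∀ {A : Set} {xs : List A} {n} {v : Vec A n} →
                All (_∈ xs) v → v ∈ vectorsOver xs n
∈-vectorsOver []       = here refl
∈-vectorsOver (p ∷ ps) = ∈-concatMap⁺ _ (lose p (∈-map⁺ _ (∈-vectorsOver ps)))

module Approximation (𝓛 : Language) where
  open Language 𝓛

  mutual
    _≟_ : DecidableEquality (Frm 𝓛)
    var x ≟ var y with x ℕ.≟ y
    ... | yes refl = yes refl
    ... | no x≢y   = no λ { refl → x≢y refl }
    var x ≟ app d bs = no λ ()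
    app c as ≟ var y = no λ ()
    app c as ≟ app d bs with c Fin.≟ d
    ... | no c≢d = no λ { refl → c≢d refl }
    ... | yes refl with as ≟ᵛ bs
    ...   | yes refl = yes refl
    ...   | no as≢bs = no λ { refl → as≢bs refl }

    _≟ᵛ_ : ∀ {n} → DecidableEquality (Vec (Frm 𝓛) n)
    [] ≟ᵛ [] = yes refl
    (a ∷ as) ≟ᵛ (b ∷ bs) with a ≟ b | as ≟ᵛ bs
    ... | yes refl | yes refl = yes refl
    ... | no a≢b   | _        = no λ { refl → a≢b refl }
    ... | _        | no as≢bs = no λ { refl → as≢bs refl }

  mutual
    subst-var : ∀ φ → subst 𝓛 var φ ≡ φ
    subst-var (var x)    = refl
    subst-var (app c as) = cong (app c) (substs-var as)

    substs-var : ∀ {n} (as : Vec (Frm 𝓛) n) → substs 𝓛 var as ≡ as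
    substs-var []       = refl
    substs-var (a ∷ as) = cong₂ _∷_ (subst-var a) (substs-var as)

  data InstancesIn (S : List (Frm 𝓛)) (σ : Substitution 𝓛) : Frm 𝓛 → Set where
    var∈ : ∀ {x} → σ x ∈ S → InstancesIn S σ (var x)
    app∈ : ∀ {c as} → app c (substs 𝓛 σ as) ∈ S → All (InstancesIn S σ) as →
           InstancesIn S σ (app c as)

  instancesIn⇒∈ : ∀ {S σ φ} → InstancesIn S σ φ → subst 𝓛 σ φ ∈ S
  instancesIn⇒∈ (var∈ p)   = p
  instancesIn⇒∈ (app∈ p _) = p

  allInstancesIn⇒∈ : ∀ {S σ n} {as : Vec (Frm 𝓛) n} →
                     All (InstancesIn S σ) as → All (_∈ S) (substs 𝓛 σ as)
  allInstancesIn⇒∈ []       = []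
  allInstancesIn⇒∈ (p ∷ ps) = instancesIn⇒∈ p ∷ allInstancesIn⇒∈ ps

  mutual
    instancesIn-mono : ∀ {S S' σ φ} → S ⊆ S' → InstancesIn S σ φ → InstancesIn S' σ φ
    instancesIn-mono S⊆S' (var∈ p)    = var∈ (S⊆S' p)
    instancesIn-mono S⊆S' (app∈ p ps) = app∈ (S⊆S' p) (allInstancesIn-mono S⊆S' ps)

    allInstancesIn-mono : ∀ {S S' σ n} {as : Vec (Frm 𝓛) n} → S ⊆ S' →
                          All (InstancesIn S σ) as → All (InstancesIn S' σ) as
    allInstancesIn-mono S⊆S' []       = []
    allInstancesIn-mono S⊆S' (p ∷ ps) = instancesIn-mono S⊆S' p ∷ allInstancesIn-mono S⊆S' ps

  module _ (S : List (Frm 𝓛)) where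

    decode : Fin (suc (length S)) → Maybe (Frm 𝓛)
    decode zero    = nothing
    decode (suc k) = just (lookup S k)

    encode : Frm 𝓛 → Fin (suc (length S))
    encode φ with _∈?_ _≟_ φ S
    ... | yes φ∈S = suc (index φ∈S)
    ... | no _    = zero

    decode≡just⇒∈ : ∀ {k ψ} → decode k ≡ just ψ → ψ ∈ S
    decode≡just⇒∈ {suc k} refl = ∈-lookup k

    decode-encode : ∀ {φ} → φ ∈ S → decode (encode φ) ≡ just φ
    decode-encode {φ} φ∈S with _∈?_ _≟_ φ S
    ... | yes p = cong just (sym (lookup-index p))
    ... | no φ∉S = contradiction φ∈S φ∉S

    decode-encode≡just : ∀ {φ ψ} → decode (encode φ) ≡ just ψ → ψ ≡ φ
    decode-encode≡just {φ} e with _∈?_ _≟_ φ S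
    decode-encode≡just refl | yes p = sym (lookup-index p)

    truncatedLindenbaum : (Frm 𝓛 → Set) → FiniteValuedLogic 𝓛
    truncatedLindenbaum L = record
      { size       = suc (length S)
      ; designated = λ k → Maybe.All L (decode k)
      ; op         = λ c ks → maybe (encode ∘ app c) zero (mapM decode ks)
      }

    module _ (L : Frm 𝓛 → Set) where
      private
        M = truncatedLindenbaum L

      readSubst : Valuation 𝓛 M → Substitution 𝓛
      readSubst v x = fromMaybe (var x) (decode (v x))

      mutual
        decode-eval≡just : ∀ v φ {ψ} → decode (eval 𝓛 M v φ) ≡ just ψ →
                           InstancesIn S (readSubst v) φ × ψ ≡ subst 𝓛 (readSubst v) φ
        decode-eval≡just v (var x) {ψ} e =
          var∈ (transport (_∈ S) (sym σx≡ψ) (decode≡just⇒∈ e)) , sym σx≡ψ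
          where
          σx≡ψ : readSubst v x ≡ ψ
          σx≡ψ = cong (fromMaybe (var x)) e
        decode-eval≡just v (app c as) {ψ} e with mapM decode (evals 𝓛 M v as) in e'
        ... | just bs with decode-evals≡just v as e'
        ...   | ps , refl = app∈ (transport (_∈ S) ψ≡ (decode≡just⇒∈ e)) ps , ψ≡
          where
          ψ≡ : ψ ≡ app c bs
          ψ≡ = decode-encode≡just e

        decode-evals≡just : ∀ v {n} (as : Vec (Frm 𝓛) n) {bs} →
                            mapM decode (evals 𝓛 M v as) ≡ just bs →
                            All (InstancesIn S (readSubst v)) as × bs ≡ substs 𝓛 (readSubst v) as
        decode-evals≡just v [] refl = [] , refl
        decode-evals≡just v (a ∷ as) e with decode (eval 𝓛 M v a) in e₁
        ... | just b with mapM decode (evals 𝓛 M v as) in e₂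
        decode-evals≡just v (a ∷ as) refl | just b | just bs
          with decode-eval≡just v a e₁ | decode-evals≡just v as e₂
        ... | p , refl | ps , refl = p ∷ ps , refl

      mutual
        decode-eval-instance : ∀ {σ φ} → InstancesIn S σ φ →
                               decode (eval 𝓛 M (encode ∘ σ) φ) ≡ just (subst 𝓛 σ φ)
        decode-eval-instance (var∈ p) = decode-encode p
        decode-eval-instance (app∈ p ps) rewrite decode-evals-instance ps = decode-encode p

        decode-evals-instance : ∀ {σ n} {as : Vec (Frm 𝓛) n} → All (InstancesIn S σ) as →
                                mapM decode (evals 𝓛 M (encode ∘ σ) as) ≡ just (substs 𝓛 σ as)
        decode-evals-instance [] = refl
        decode-evals-instance (p ∷ ps)
          rewrite decode-eval-instance p | decode-evals-instance ps = refl

      taut-truncatedLindenbaum⇔ : ∀ φ →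
        Taut 𝓛 M φ ⇔ (∀ σ → InstancesIn S σ φ → L (subst 𝓛 σ φ))
      taut-truncatedLindenbaum⇔ φ = mk⇔ instances-in-L designated
        where
        instances-in-L : Taut 𝓛 M φ → ∀ σ → InstancesIn S σ φ → L (subst 𝓛 σ φ)
        instances-in-L taut σ i =
          Maybe.drop-just (transport (Maybe.All L) (decode-eval-instance i) (taut (encode ∘ σ)))

        designated : (∀ σ → InstancesIn S σ φ → L (subst 𝓛 σ φ)) → Taut 𝓛 M φ
        designated inL v with decode (eval 𝓛 M v φ) in e
        ... | nothing = Maybe.nothing
        ... | just ψ with decode-eval≡just v φ e
        ...   | i , refl = Maybe.just (inL (readSubst v) i)

  module _ (L : Frm 𝓛 → Set) where
    open Equivalence

    L⊆Taut-truncatedLindenbaum : ClosedUnderSubst 𝓛 L → ∀ S {φ} → L φ →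
                                 Taut 𝓛 (truncatedLindenbaum S L) φ
    L⊆Taut-truncatedLindenbaum closed S {φ} Lφ =
      from (taut-truncatedLindenbaum⇔ S L φ) λ σ _ → closed σ φ Lφ

    truncatedLindenbaum-antitone : ∀ {S S'} → S ⊆ S' →
                                   _⊴_ 𝓛 (truncatedLindenbaum S' L) (truncatedLindenbaum S L)
    truncatedLindenbaum-antitone {S} {S'} S⊆S' φ taut =
      from (taut-truncatedLindenbaum⇔ S L φ) λ σ i →
        to (taut-truncatedLindenbaum⇔ S' L φ) taut σ (instancesIn-mono S⊆S' i)

    Taut-truncatedLindenbaum⇒L : ∀ {S φ} → InstancesIn S var φ →
                                 Taut 𝓛 (truncatedLindenbaum S L) φ → L φ
    Taut-truncatedLindenbaum⇒L {S} {φ} i taut =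
      transport L (subst-var φ) (to (taut-truncatedLindenbaum⇔ S L φ) taut var i)

  stage : ℕ → List (Frm 𝓛)
  stage zero    = []
  stage (suc j) = stage j ++ var j ∷ concatMap composites (allFin nConn)
    where
    composites : (c : Fin nConn) → List (Frm 𝓛)
    composites c = map (app c) (vectorsOver (stage j) (arity c))

  stage-mono : ∀ {j i} → j ≤ i → stage j ⊆ stage i
  stage-mono j≤i = go (≤⇒≤′ j≤i)
    where
    go : ∀ {j i} → j ≤′ i → stage j ⊆ stage i
    go ≤′-refl       = ⊆-refl
    go (≤′-step j≤i) = ⊆-trans (go j≤i) (xs⊆xs++ys _ _)

  var∈stage : ∀ x → var x ∈ stage (suc x)
  var∈stage x = ∈-++⁺ʳ (stage x) (here refl)

  app∈stage : ∀ {j c} {as : Vec (Frm 𝓛) (arity c)} →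
              All (_∈ stage j) as → app c as ∈ stage (suc j)
  app∈stage {j} {c} as∈ = ∈-++⁺ʳ (stage j) (there (∈-concatMap⁺ _
    (lose (∈-allFin c) (∈-map⁺ (app c) (∈-vectorsOver as∈)))))

  mutual
    instancesIn-stage : ∀ φ → ∃ λ j → InstancesIn (stage j) var φ
    instancesIn-stage (var x) = suc x , var∈ (var∈stage x)
    instancesIn-stage (app c as) with allInstancesIn-stage as
    ... | j , ps = suc j , app∈ (app∈stage (allInstancesIn⇒∈ ps))
                                 (allInstancesIn-mono (stage-mono (n≤1+n j)) ps)

    allInstancesIn-stage : ∀ {n} (as : Vec (Frm 𝓛) n) →
                           ∃ λ j → All (InstancesIn (stage j) var) as
    allInstancesIn-stage []       = zero , []
    allInstancesIn-stage (a ∷ as) with instancesIn-stage a | allInstancesIn-stage as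
    ... | j , p | k , ps = j ⊔ k , instancesIn-mono (stage-mono (m≤m⊔n j k)) p
                                 ∷ allInstancesIn-mono (stage-mono (m≤n⊔m j k)) ps

proposition7 : (𝓛 : Language) (L : Frm 𝓛 → Set) → ClosedUnderSubst 𝓛 L →
    Σ (ℕ → FiniteValuedLogic 𝓛) (λ M → SequentialApproximation 𝓛 L M)
proposition7 𝓛 L closed = M , antitone , λ φ → mk⇔ (sound φ) (complete φ)
  where
  open Approximation 𝓛

  M : ℕ → FiniteValuedLogic 𝓛
  M j = truncatedLindenbaum (stage j) L

  antitone : ∀ i j → i ≥ j → _⊴_ 𝓛 (M i) (M j)
  antitone i j j≤i = truncatedLindenbaum-antitone L (stage-mono j≤i)

  sound : ∀ φ → L φ → ∀ j → Taut 𝓛 (M j) φ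
  sound φ Lφ j = L⊆Taut-truncatedLindenbaum L closed (stage j) Lφ

  complete : ∀ φ → (∀ j → Taut 𝓛 (M j) φ) → L φ
  complete φ taut with instancesIn-stage φ
  ... | j , i = Taut-truncatedLindenbaum⇒L L i (taut j)
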